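{- Let $k\in\mathbb{Z}_{\geq 0}$ and consider the Diophantine equation \[x^2+y^4+z^4+ky^2z^2+2xy^2+2xz^2=(7+k)xy^2z^2. \qquad (\ast\ast)\] Every positive integer solution $(x,y,z)$ of $(\ast\ast)$ appears exactly once as a vertex of the tree $\mathbb{T}^{k}$ (defined in the context).
   Context: The tree $\mathbb{T}^{k}$ has triplets of positive integers as vertices and is built as follows. (1) The root vertex is $(1,1,1)$. (2) The root $(1,1,1)$ has exactly three children: $(k+2,1,1)$, $(1,2,1)$, $(1,1,2)$. (3) Every vertex $(a,b,c)$ other than the root has exactly two children, determined as follows: (i) if $a$ is the maximal number in $(a,b^2,c^2)$, the children are $\left(a,\frac{a+c^2}{b},c\right)$ and $\left(a,b,\frac{a+b^2}{c}\right)$; (ii) if $b^2$ is the maximal number in $(a,b^2,c^2)$, the children are $\left(\frac{b^4+kb^2c^2+c^4}{a},b,c\right)$ and $\left(a,b,\frac{a+b^2}{c}\right)$; (iii) if $c^2$ is the maximal number in $(a,b^2,c^2)$, the children are $\left(\frac{b^4+kb^2c^2+c^4}{a},b,c\right)$ and $\left(a,\frac{a+c^2}{b},c\right)$. -}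

module Defs where

open import Data.Nat using (ℕ; _+_; _*_; _^_; _≤_; _<_)
open import Relation.Binary.PropositionalEquality using (_≡_)

-- Which of the three rules of the tree 𝕋^k applies at a non-root vertex (a,b,c).
-- Ties in the maximum are resolved in the order (i), (ii), (iii).
Case-i : ℕ → ℕ → ℕ → Set
Case-i a b c = (b ^ 2 ≤ a) × (c ^ 2 ≤ a)
  where open import Data.Product using (_×_)

Case-ii : ℕ → ℕ → ℕ → Set
Case-ii a b c = (a < b ^ 2) × (c ^ 2 ≤ b ^ 2)
  where open import Data.Product using (_×_)

Case-iii : ℕ → ℕ → ℕ → Set
Case-iii a b c = (a < c ^ 2) × (b ^ 2 < c ^ 2)
  where open import Data.Product using (_×_)

-- The inhabitants encode the path from the
-- root, so distinct inhabitants are distinct vertices.  Exact divisions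
-- "a' = N / a" are expressed as "a' * a ≡ N".
data NonRoot (k : ℕ) : ℕ → ℕ → ℕ → Set where
  child₁ : NonRoot k (k + 2) 1 1
  child₂ : NonRoot k 1 2 1
  child₃ : NonRoot k 1 1 2
  i-b  : ∀ {a b c b'} → NonRoot k a b c → Case-i a b c →
         b' * b ≡ a + c ^ 2 → NonRoot k a b' c
  i-c  : ∀ {a b c c'} → NonRoot k a b c → Case-i a b c →
         c' * c ≡ a + b ^ 2 → NonRoot k a b c'
  ii-a : ∀ {a b c a'} → NonRoot k a b c → Case-ii a b c →
         a' * a ≡ b ^ 4 + k * b ^ 2 * c ^ 2 + c ^ 4 → NonRoot k a' b c
  ii-c : ∀ {a b c c'} → NonRoot k a b c → Case-ii a b c →
         c' * c ≡ a + b ^ 2 → NonRoot k a b c'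
  iii-a : ∀ {a b c a'} → NonRoot k a b c → Case-iii a b c →
          a' * a ≡ b ^ 4 + k * b ^ 2 * c ^ 2 + c ^ 4 → NonRoot k a' b c
  iii-b : ∀ {a b c b'} → NonRoot k a b c → Case-iii a b c →
          b' * b ≡ a + c ^ 2 → NonRoot k a b' c

data Vertex (k : ℕ) : ℕ → ℕ → ℕ → Set where
  root    : Vertex k 1 1 1
  nonroot : ∀ {a b c} → NonRoot k a b c → Vertex k a b c

Sol : ℕ → ℕ → ℕ → ℕ → Set
Sol k x y z =
  x ^ 2 + y ^ 4 + z ^ 4 + k * y ^ 2 * z ^ 2 + 2 * x * y ^ 2 + 2 * x * z ^ 2
    ≡ (7 + k) * x * y ^ 2 * z ^ 2

{-# OPTIONS --safe #-}
-- Vieta jumping.  For fixed b, c the equation is a quadratic in a whose two roots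
-- multiply to b⁴ + k b²c² + c⁴; as a quadratic in b² its roots multiply to
-- (a + c²)², so b·b′ = a + c², and symmetrically in c.  Replacing the coordinate
-- singled out by the case (i)–(iii) of a solution by its partner root strictly
-- decreases it unless the solution is (1,1,1): otherwise the quadratic, evaluated at
-- the dominant one of the remaining terms, would be (x − m)(y − m) ≥ 0 with m below
-- both roots, while the equation forces it to be negative.  Reversing this descent
-- is a path in 𝕋ᵏ, giving existence.  For uniqueness, the case of a vertex
-- determines which coordinate its last move changed, cancellation then determines
-- the parent's label, and induction on paths concludes.

module Submission where

open import Data.Empty using (⊥; ⊥-elim)
open import Data.List using (_∷_; [])
open import Data.Nat
open import Data.Nat.DivMod using (_/_; m/n*n≡m)
open import Data.Nat.Coprimality using (Coprime; coprime-/gcd; coprime-divisor)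
open import Data.Nat.Divisibility
open import Data.Nat.GCD
open import Data.Nat.Properties
open import Data.Nat.Tactic.RingSolver using (solve)
open import Data.Product
open import Data.Sum using (inj₁; inj₂; [_,_]′)
open import Function using (_∘_)
open import Function.Bundles using (_⇔_; mk⇔; Equivalence)
open import Function.Construct.Composition using (_⇔-∘_)
open import Relation.Binary.PropositionalEquality
open import Relation.Nullary using (¬_; Dec; yes; no)
open import Relation.Nullary.Decidable using (_×-dec_)
open import Induction.WellFounded using (Acc; acc)
open import Data.Nat.Induction using (<-wellFounded)

open import Defs

open ≡-Reasoning
open Equivalence using (to; from)

variable
  k a b c m n o p q s t x y B C : ℕ

-- Arithmetic

n^2≡n*n : ∀ n → n ^ 2 ≡ n * n
n^2≡n*n n = cong (n *_) (*-identityʳ n)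

n^2>0 : 0 < n → 0 < n ^ 2
n^2>0 {n} 0<n = m^n>0 n {{>-nonZero 0<n}} 2

n^2≡1⇒n≡1 : n ^ 2 ≡ 1 → n ≡ 1
n^2≡1⇒n≡1 {n} = m*n≡1⇒m≡1 n (n * 1)

m^2*n^2≡[m*n]^2 : ∀ m n → m ^ 2 * n ^ 2 ≡ (m * n) ^ 2
m^2*n^2≡[m*n]^2 m n rewrite n^2≡n*n m | n^2≡n*n n | n^2≡n*n (m * n) = solve (m ∷ n ∷ [])

m*n≡o⇒m^2*n^2≡o*o : m * n ≡ o → m ^ 2 * n ^ 2 ≡ o * o
m*n≡o⇒m^2*n^2≡o*o {m} {n} {o} e = trans (m^2*n^2≡[m*n]^2 m n) (trans (cong (_^ 2) e) (n^2≡n*n o))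

positive-factor : m * n ≡ o → 0 < o → 0 < m
positive-factor {zero} refl ()
positive-factor {suc m} _ _ = z<s

cancel-factor : 0 < o → o * m ≡ n → o * p ≡ n → m ≡ p
cancel-factor {o} {m} {n} {p} 0<o e e′ = *-cancelˡ-≡ m p o {{>-nonZero 0<o}} (trans e (sym e′))

m+n≡o⇒m≤o : m + n ≡ o → m ≤ o
m+n≡o⇒m≤o {m} {n} e = subst (m ≤_) e (m≤m+n m n)

m^2<n⇒n<o^2 : ∀ m o → m ^ 2 < n → o * m ≡ n → n < o ^ 2
m^2<n⇒n<o^2 {n} m o m²<n e = subst₂ _<_ e (sym (n^2≡n*n o)) (*-monoʳ-< o {{>-nonZero 0<o}} m<o)
  where
  m<o : m < o
  m<o = ≰⇒> λ o≤m → <⇒≱ m²<n (subst₂ _≤_ e (sym (n^2≡n*n m)) (*-monoˡ-≤ m o≤m))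
  0<o : 0 < o
  0<o = ≤-<-trans z≤n m<o

m^2<n^2⇒m<n : ∀ m n → m ^ 2 < n ^ 2 → m < n
m^2<n^2⇒m<n m n m²<n² = ≰⇒> λ n≤m → <⇒≱ m²<n² (^-monoˡ-≤ 2 n≤m)

m*m∣n*n⇒m∣n : .{{NonZero m}} → m * m ∣ n * n → m ∣ n
m*m∣n*n⇒m∣n {m} {n} mm∣nn = subst (_∣ n) (sym m≡g) (gcd[m,n]∣n m n)
  where
  g = gcd m n
  instance
    g≢0 : NonZero g
    g≢0 = ≢-nonZero (gcd[m,n]≢0 m n (inj₁ (≢-nonZero⁻¹ m)))
  m′ = m / g
  n′ = n / g
  m′g≡m : m′ * g ≡ m
  m′g≡m = m/n*n≡m (gcd[m,n]∣m m n)
  n′g≡n : n′ * g ≡ n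
  n′g≡n = m/n*n≡m (gcd[m,n]∣n m n)
  square : ∀ x y → (x * y) * (x * y) ≡ (x * x) * (y * y)
  square x y = solve (x ∷ y ∷ [])
  m′∣n′n′ : m′ ∣ n′ * n′
  m′∣n′n′ = m*n∣⇒m∣ m′ m′ (*-cancelʳ-∣ (g * g) {{m*n≢0 g g}}
    (subst₂ _∣_ (trans (cong₂ _*_ (sym m′g≡m) (sym m′g≡m)) (square m′ g))
                (trans (cong₂ _*_ (sym n′g≡n) (sym n′g≡n)) (square n′ g)) mm∣nn))
  cop : Coprime m′ n′
  cop = coprime-/gcd m n
  m≡g : m ≡ g
  m≡g = begin
    m        ≡⟨ sym m′g≡m ⟩
    m′ * g   ≡⟨ cong (_* g) (cop (∣-refl , coprime-divisor cop m′∣n′n′)) ⟩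
    1 * g    ≡⟨ *-identityˡ g ⟩
    g        ∎

-- Vieta jumping

-- x is a root of X² − (q − p) X + n, written without subtraction.
record QuadRoot (p n q x : ℕ) : Set where
  constructor quadRoot
  field equation : x * (x + p) + n ≡ x * q

quadRoot⇒∣ : QuadRoot p n q x → x ∣ n
quadRoot⇒∣ {p} {n} {q} {x} (quadRoot r) = ∣m+n∣m⇒∣n (subst (x ∣_) (sym r) (m∣m*n q)) (m∣m*n (x + p))

vieta-sum : .{{NonZero x}} → QuadRoot p n q x → y * x ≡ n → x + y + p ≡ q
vieta-sum {x} {p} {n} {q} {y} (quadRoot r) e = *-cancelˡ-≡ _ _ x (begin
  x * (x + y + p)      ≡⟨ solve (x ∷ y ∷ p ∷ []) ⟩
  x * (x + p) + y * x  ≡⟨ cong (x * (x + p) +_) e ⟩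
  x * (x + p) + n      ≡⟨ r ⟩
  x * q                ∎)

vieta-partner : .{{NonZero x}} → QuadRoot p n q x → y * x ≡ n → QuadRoot p n q y
vieta-partner {x} {p} {n} {q} {y} r e = quadRoot (begin
  y * (y + p) + n      ≡⟨ cong (y * (y + p) +_) (sym e) ⟩
  y * (y + p) + y * x  ≡⟨ solve (x ∷ y ∷ p ∷ []) ⟩
  y * (x + y + p)      ≡⟨ cong (y *_) (vieta-sum {y = y} r e) ⟩
  y * q                ∎)

vieta-jump : .{{NonZero x}} → QuadRoot p n q x → ∃[ y ] y * x ≡ n × QuadRoot p n q y
vieta-jump r with quadRoot⇒∣ r
... | divides y n≡yx = y , sym n≡yx , vieta-partner r (sym n≡yx)

-- The quadratic evaluated at a point m below both roots x ≤ y is (x − m)(y − m).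
vieta-gap : .{{NonZero x}} → m ≤ x → m ≤ y → QuadRoot p n q x → y * x ≡ n →
            m * q + (x ∸ m) * (y ∸ m) ≡ m * (m + p) + n
vieta-gap {x} {m} {y} {p} {n} {q} m≤x m≤y r e = begin
  m * q + (x ∸ m) * (y ∸ m)
    ≡⟨ cong (λ s → m * s + (x ∸ m) * (y ∸ m)) (sym (vieta-sum {y = y} r e)) ⟩
  m * (x + y + p) + (x ∸ m) * (y ∸ m)
    ≡⟨ cong₂ (λ x′ y′ → m * (x′ + y′ + p) + (x ∸ m) * (y ∸ m)) (sym x≡) (sym y≡) ⟩
  m * (m + (x ∸ m) + (m + (y ∸ m)) + p) + (x ∸ m) * (y ∸ m)
    ≡⟨ offsets (x ∸ m) (y ∸ m) ⟩
  m * (m + p) + (m + (y ∸ m)) * (m + (x ∸ m))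
    ≡⟨ cong₂ (λ x′ y′ → m * (m + p) + y′ * x′) x≡ y≡ ⟩
  m * (m + p) + y * x
    ≡⟨ cong (m * (m + p) +_) e ⟩
  m * (m + p) + n
    ∎
  where
  x≡ = m+[n∸m]≡n m≤x
  y≡ = m+[n∸m]≡n m≤y
  offsets : ∀ u v → m * (m + u + (m + v) + p) + u * v ≡ m * (m + p) + (m + v) * (m + u)
  offsets u v = solve (m ∷ u ∷ v ∷ p ∷ [])

vieta-gap≡0 : m ≤ x → x ≤ y → (x ∸ m) * (y ∸ m) ≡ 0 → x ≡ m
vieta-gap≡0 {m} {x} {y} m≤x x≤y gap≡0 with m*n≡0⇒m≡0∨n≡0 (x ∸ m) gap≡0
... | inj₁ x∸m≡0 = ≤-antisym (m∸n≡0⇒m≤n x∸m≡0) m≤x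
... | inj₂ y∸m≡0 = ≤-antisym (≤-trans x≤y (m∸n≡0⇒m≤n y∸m≡0)) m≤x

-- The equation (**)

quartic : ℕ → ℕ → ℕ → ℕ
quartic k b c = b ^ 4 + k * b ^ 2 * c ^ 2 + c ^ 4

quartic-in-squares : ∀ k b c → quartic k b c ≡ b ^ 2 * b ^ 2 + k * b ^ 2 * c ^ 2 + c ^ 2 * c ^ 2
quartic-in-squares k b c rewrite ^-distribˡ-+-* b 2 2 | ^-distribˡ-+-* c 2 2 = refl

quartic-swap : ∀ k b c → quartic k b c ≡ quartic k c b
quartic-swap k b c = commuted (b ^ 4) (c ^ 4) (b ^ 2) (c ^ 2)
  where
  commuted : ∀ P Q X Y → P + k * X * Y + Q ≡ Q + k * Y * X + P
  commuted P Q X Y = solve (k ∷ P ∷ Q ∷ X ∷ Y ∷ [])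

quartic-positive : ∀ k b c → 0 < b → 0 < quartic k b c
quartic-positive k b c 0<b = ≤-trans (m^n>0 b {{>-nonZero 0<b}} 4) (≤-trans (m≤m+n _ _) (m≤m+n _ _))

quartic-1-1 : ∀ k → quartic k 1 1 ≡ k + 2
quartic-1-1 k = begin
  1 + k * 1 * 1 + 1  ≡⟨ solve (k ∷ []) ⟩
  k + 2              ∎

b⁴≤quartic : ∀ k b c → (b ^ 2) ^ 2 ≤ quartic k b c
b⁴≤quartic k b c = subst (_≤ quartic k b c) (sym (^-*-assoc b 2 2)) (≤-trans (m≤m+n _ _) (m≤m+n _ _))

c⁴≤quartic : ∀ k b c → (c ^ 2) ^ 2 ≤ quartic k b c
c⁴≤quartic k b c = subst (_≤ quartic k b c) (sym (^-*-assoc c 2 2)) (m≤n+m _ _)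

Sol² : ℕ → ℕ → ℕ → ℕ → Set
Sol² k a B C = a * a + B * B + C * C + k * B * C + 2 * a * B + 2 * a * C ≡ (7 + k) * a * B * C

rearranged : {l l′ r r′ : ℕ} → l ≡ l′ → r ≡ r′ → (l ≡ r) ⇔ (l′ ≡ r′)
rearranged l≡l′ r≡r′ = mk⇔ (subst₂ _≡_ l≡l′ r≡r′) (subst₂ _≡_ (sym l≡l′) (sym r≡r′))

sol⇔sol² : Sol k a b c ⇔ Sol² k a (b ^ 2) (c ^ 2)
sol⇔sol² {k} {a} {b} {c} = rearranged lhs refl
  where
  lhs : a ^ 2 + b ^ 4 + c ^ 4 + k * b ^ 2 * c ^ 2 + 2 * a * b ^ 2 + 2 * a * c ^ 2
      ≡ a * a + b ^ 2 * b ^ 2 + c ^ 2 * c ^ 2 + k * b ^ 2 * c ^ 2 + 2 * a * b ^ 2 + 2 * a * c ^ 2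
  lhs rewrite n^2≡n*n a | ^-distribˡ-+-* b 2 2 | ^-distribˡ-+-* c 2 2 = refl

sol²⇔rootᵃ : Sol² k a B C ⇔ QuadRoot (2 * B + 2 * C) (B * B + k * B * C + C * C) ((7 + k) * B * C) a
sol²⇔rootᵃ {k} {a} {B} {C} = mk⇔ quadRoot QuadRoot.equation ⇔-∘ rearranged lhs rhs
  where
  lhs : a * a + B * B + C * C + k * B * C + 2 * a * B + 2 * a * C
      ≡ a * (a + (2 * B + 2 * C)) + (B * B + k * B * C + C * C)
  lhs = solve (k ∷ a ∷ B ∷ C ∷ [])
  rhs : (7 + k) * a * B * C ≡ a * ((7 + k) * B * C)
  rhs = solve (k ∷ a ∷ B ∷ C ∷ [])

sol²⇔rootᴮ : Sol² k a B C ⇔ QuadRoot (k * C + 2 * a) ((a + C) * (a + C)) ((7 + k) * a * C) B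
sol²⇔rootᴮ {k} {a} {B} {C} = mk⇔ quadRoot QuadRoot.equation ⇔-∘ rearranged lhs rhs
  where
  lhs : a * a + B * B + C * C + k * B * C + 2 * a * B + 2 * a * C
      ≡ B * (B + (k * C + 2 * a)) + (a + C) * (a + C)
  lhs = solve (k ∷ a ∷ B ∷ C ∷ [])
  rhs : (7 + k) * a * B * C ≡ B * ((7 + k) * a * C)
  rhs = solve (k ∷ a ∷ B ∷ C ∷ [])

sol²-swap : Sol² k a B C → Sol² k a C B
sol²-swap {k} {a} {B} {C} = to (rearranged lhs rhs)
  where
  lhs : a * a + B * B + C * C + k * B * C + 2 * a * B + 2 * a * C
      ≡ a * a + C * C + B * B + k * C * B + 2 * a * C + 2 * a * B
  lhs = solve (k ∷ a ∷ B ∷ C ∷ [])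
  rhs : (7 + k) * a * B * C ≡ (7 + k) * a * C * B
  rhs = solve (k ∷ a ∷ B ∷ C ∷ [])

sol⇔rootᵃ : ∀ k a b c → Sol k a b c ⇔
  QuadRoot (2 * b ^ 2 + 2 * c ^ 2) (b ^ 2 * b ^ 2 + k * b ^ 2 * c ^ 2 + c ^ 2 * c ^ 2)
           ((7 + k) * b ^ 2 * c ^ 2) a
sol⇔rootᵃ k a b c = sol²⇔rootᵃ {k} {a} {b ^ 2} {c ^ 2} ⇔-∘ sol⇔sol² {k} {a} {b} {c}

sol⇔rootᵇ : ∀ k a b c → Sol k a b c ⇔
  QuadRoot (k * c ^ 2 + 2 * a) ((a + c ^ 2) * (a + c ^ 2)) ((7 + k) * a * c ^ 2) (b ^ 2)
sol⇔rootᵇ k a b c = sol²⇔rootᴮ {k} {a} {b ^ 2} {c ^ 2} ⇔-∘ sol⇔sol² {k} {a} {b} {c}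

sol-swap : ∀ k a b c → Sol k a b c → Sol k a c b
sol-swap k a b c =
  from (sol⇔sol² {k} {a} {c} {b}) ∘ sol²-swap {k} {a} {b ^ 2} {c ^ 2} ∘ to (sol⇔sol² {k} {a} {b} {c})

a-jump : ∀ k a b c → 0 < a → Sol k a b c → ∃[ s ] s * a ≡ quartic k b c × Sol k s b c
a-jump k a b c 0<a sol =
  a′ , trans a′a≡ (sym (quartic-in-squares k b c)) , from (sol⇔rootᵃ k a′ b c) r′
  where
  jump = vieta-jump {{>-nonZero 0<a}} (to (sol⇔rootᵃ k a b c) sol)
  a′ = proj₁ jump
  a′a≡ = proj₁ (proj₂ jump)
  r′ = proj₂ (proj₂ jump)

sol⇒b∣a+c² : 0 < b → Sol k a b c → b ∣ a + c ^ 2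
sol⇒b∣a+c² {b} {k} {a} {c} 0<b sol = m*m∣n*n⇒m∣n {b} {a + c ^ 2} {{>-nonZero 0<b}}
  (subst (_∣ (a + c ^ 2) * (a + c ^ 2)) (n^2≡n*n b) (quadRoot⇒∣ (to (sol⇔rootᵇ k a b c) sol)))

b-jump : ∀ k a b c → 0 < b → Sol k a b c → ∃[ t ] t * b ≡ a + c ^ 2 × Sol k a t c
b-jump k a b c 0<b sol = b′ , b′b≡ , from (sol⇔rootᵇ k a b′ c) r′
  where
  instance _ = m^n≢0 b 2 {{>-nonZero 0<b}}
  b∣ = sol⇒b∣a+c² {b} {k} {a} {c} 0<b sol
  b′ = quotient b∣
  b′b≡ : b′ * b ≡ a + c ^ 2
  b′b≡ = sym (m∣n⇒n≡quotient*m b∣)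
  r′ : QuadRoot (k * c ^ 2 + 2 * a) ((a + c ^ 2) * (a + c ^ 2)) ((7 + k) * a * c ^ 2) (b′ ^ 2)
  r′ = vieta-partner (to (sol⇔rootᵇ k a b c) sol) (m*n≡o⇒m^2*n^2≡o*o {b′} {b} {a + c ^ 2} b′b≡)

c-jump : ∀ k a b c → 0 < c → Sol k a b c → ∃[ t ] t * c ≡ a + b ^ 2 × Sol k a b t
c-jump k a b c 0<c sol =
  let (t , tc≡ , sol′) = b-jump k a c b 0<c (sol-swap k a b c sol)
  in  t , tc≡ , sol-swap k a t b sol′

-- Descent

-- The only solutions of these boundary equations: each monomial on the right is
-- dominated by its partner on the left, strictly once the larger variable exceeds 1.
boundary₁ : ∀ k B C w → 1 ≤ C → C ≤ B →
  (7 + k) * B * B * C + w ≡ 4 * B * B + 2 * B * C + C * C + k * B * C → B ≡ 1 × C ≡ 1 × w ≡ 0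
boundary₁ k zero C w (s≤s _) ()
boundary₁ k 1 .1 w (s≤s z≤n) (s≤s z≤n) e = refl , refl , +-cancelˡ-≡ ((7 + k) * 1 * 1 * 1) w 0 (trans e at-1)
  where
  at-1 : 4 * 1 * 1 + 2 * 1 * 1 + 1 * 1 + k * 1 * 1 ≡ (7 + k) * 1 * 1 * 1 + 0
  at-1 = solve (k ∷ [])
boundary₁ k B@(suc (suc _)) C w 1≤C C≤B e = ⊥-elim (<⇒≱ dominated (m+n≡o⇒m≤o e))
  where
  instance
    _ = >-nonZero 1≤C
    _ = m*n≢0 (2 * B) C
  expand : ∀ k B C → (7 + k) * B * B * C ≡ 4 * B * B * C + 2 * B * C * B + C * (B * B) + k * B * C * B
  expand k B C = solve (k ∷ B ∷ C ∷ [])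
  termwise : 4 * B * B + 2 * B * C + C * C + k * B * C < 4 * B * B * C + 2 * B * C * B + C * (B * B) + k * B * C * B
  termwise =
    +-mono-<-≤ (+-mono-<-≤ (+-mono-≤-< (m≤m*n (4 * B * B) C) (m<m*n (2 * B * C) B (s≤s (s≤s z≤n))))
                            (*-monoʳ-≤ C (≤-trans C≤B (m≤m*n B B))))
                (m≤m*n (k * B * C) B)
  dominated : 4 * B * B + 2 * B * C + C * C + k * B * C < (7 + k) * B * B * C
  dominated = <-≤-trans termwise (≤-reflexive (sym (expand k B C)))

boundary₂ : ∀ k a C w → 1 ≤ a → a ≤ C →
  (7 + k) * a * C * C + w ≡ a * a + 4 * a * C + 2 * C * C + k * C * C → a ≡ 1 × C ≡ 1 × w ≡ 0
boundary₂ k a zero w (s≤s _) ()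
boundary₂ k .1 1 w (s≤s z≤n) (s≤s z≤n) e = refl , refl , +-cancelˡ-≡ ((7 + k) * 1 * 1 * 1) w 0 (trans e at-1)
  where
  at-1 : 1 * 1 + 4 * 1 * 1 + 2 * 1 * 1 + k * 1 * 1 ≡ (7 + k) * 1 * 1 * 1 + 0
  at-1 = solve (k ∷ [])
boundary₂ k a C@(suc (suc _)) w 1≤a a≤C e = ⊥-elim (<⇒≱ dominated (m+n≡o⇒m≤o e))
  where
  instance
    _ = >-nonZero 1≤a
    _ = m*n≢0 (4 * a) C {{m*n≢0 4 a {{_}} {{>-nonZero 1≤a}}}}
  expand : ∀ k a C → (7 + k) * a * C * C ≡ a * (C * C) + 4 * a * C * C + 2 * C * C * a + k * C * C * a
  expand k a C = solve (k ∷ a ∷ C ∷ [])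
  termwise : a * a + 4 * a * C + 2 * C * C + k * C * C < a * (C * C) + 4 * a * C * C + 2 * C * C * a + k * C * C * a
  termwise =
    +-mono-<-≤ (+-mono-<-≤ (+-mono-≤-< (*-monoʳ-≤ a (≤-trans a≤C (m≤m*n C C)))
                                        (m<m*n (4 * a * C) C (s≤s (s≤s z≤n))))
                            (m≤m*n (2 * C * C) a))
                (m≤m*n (k * C * C) a)
  dominated : a * a + 4 * a * C + 2 * C * C + k * C * C < (7 + k) * a * C * C
  dominated = <-≤-trans termwise (≤-reflexive (sym (expand k a C)))

gap-at-B : ∀ k B C x y → QuadRoot (2 * B + 2 * C) (B * B + k * B * C + C * C) ((7 + k) * B * C) x →
  y * x ≡ B * B + k * B * C + C * C → 1 ≤ C → C ≤ B → B ≤ x → x ≤ y → B ≡ 1 × C ≡ 1 × x ≡ B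
gap-at-B k B C x y r e 1≤C C≤B B≤x x≤y =
  let (B≡1 , C≡1 , w≡0) = boundary₁ k B C w 1≤C C≤B boundary-eq
  in  B≡1 , C≡1 , vieta-gap≡0 B≤x x≤y w≡0
  where
  instance _ = >-nonZero (≤-trans (≤-trans 1≤C C≤B) B≤x)
  w = (x ∸ B) * (y ∸ B)
  expand : (7 + k) * B * B * C ≡ B * ((7 + k) * B * C)
  expand = solve (k ∷ B ∷ C ∷ [])
  boundary-eq : (7 + k) * B * B * C + w ≡ 4 * B * B + 2 * B * C + C * C + k * B * C
  boundary-eq = begin
    (7 + k) * B * B * C + w                                 ≡⟨ cong (_+ w) expand ⟩
    B * ((7 + k) * B * C) + w                               ≡⟨ vieta-gap B≤x (≤-trans B≤x x≤y) r e ⟩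
    B * (B + (2 * B + 2 * C)) + (B * B + k * B * C + C * C) ≡⟨ solve (k ∷ B ∷ C ∷ []) ⟩
    4 * B * B + 2 * B * C + C * C + k * B * C               ∎

gap-at-a : ∀ k a C x y → QuadRoot (k * C + 2 * a) ((a + C) * (a + C)) ((7 + k) * a * C) x →
  y * x ≡ (a + C) * (a + C) → 1 ≤ C → C ≤ a → a ≤ x → x ≤ y → x ≡ a
gap-at-a k a C x y r e 1≤C C≤a a≤x x≤y =
  let (_ , _ , w≡0) = boundary₁ k a C w 1≤C C≤a boundary-eq
  in  vieta-gap≡0 a≤x x≤y w≡0
  where
  instance _ = >-nonZero (≤-trans (≤-trans 1≤C C≤a) a≤x)
  w = (x ∸ a) * (y ∸ a)
  expand : (7 + k) * a * a * C ≡ a * ((7 + k) * a * C)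
  expand = solve (k ∷ a ∷ C ∷ [])
  boundary-eq : (7 + k) * a * a * C + w ≡ 4 * a * a + 2 * a * C + C * C + k * a * C
  boundary-eq = begin
    (7 + k) * a * a * C + w                        ≡⟨ cong (_+ w) expand ⟩
    a * ((7 + k) * a * C) + w                      ≡⟨ vieta-gap a≤x (≤-trans a≤x x≤y) r e ⟩
    a * (a + (k * C + 2 * a)) + (a + C) * (a + C)  ≡⟨ solve (k ∷ a ∷ C ∷ []) ⟩
    4 * a * a + 2 * a * C + C * C + k * a * C      ∎

gap-at-C : ∀ k a C x y → QuadRoot (k * C + 2 * a) ((a + C) * (a + C)) ((7 + k) * a * C) x →
  y * x ≡ (a + C) * (a + C) → 1 ≤ a → a ≤ C → C ≤ x → x ≤ y → C ≡ 1 × x ≡ C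
gap-at-C k a C x y r e 1≤a a≤C C≤x x≤y =
  let (_ , C≡1 , w≡0) = boundary₂ k a C w 1≤a a≤C boundary-eq
  in  C≡1 , vieta-gap≡0 C≤x x≤y w≡0
  where
  instance _ = >-nonZero (≤-trans (≤-trans 1≤a a≤C) C≤x)
  w = (x ∸ C) * (y ∸ C)
  expand : (7 + k) * a * C * C ≡ C * ((7 + k) * a * C)
  expand = solve (k ∷ a ∷ C ∷ [])
  boundary-eq : (7 + k) * a * C * C + w ≡ a * a + 4 * a * C + 2 * C * C + k * C * C
  boundary-eq = begin
    (7 + k) * a * C * C + w                        ≡⟨ cong (_+ w) expand ⟩
    C * ((7 + k) * a * C) + w                      ≡⟨ vieta-gap C≤x (≤-trans C≤x x≤y) r e ⟩
    C * (C + (k * C + 2 * a)) + (a + C) * (a + C)  ≡⟨ solve (k ∷ a ∷ C ∷ []) ⟩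
    a * a + 4 * a * C + 2 * C * C + k * C * C      ∎

RootLabel : ℕ → ℕ → ℕ → Set
RootLabel a b c = a ≡ 1 × b ≡ 1 × c ≡ 1

a-descent-ordered : ∀ k a b c s → 0 < c → Sol k a b c → c ^ 2 ≤ b ^ 2 → b ^ 2 ≤ a →
                    s * a ≡ quartic k b c → a ≤ s → RootLabel a b c
a-descent-ordered k a b c s 0<c sol C≤B B≤a e a≤s =
  let (B≡1 , C≡1 , a≡B) = gap-at-B k (b ^ 2) (c ^ 2) a s (to (sol⇔rootᵃ k a b c) sol)
                                   (trans e (quartic-in-squares k b c)) (n^2>0 0<c) C≤B B≤a a≤s
  in  trans a≡B B≡1 , n^2≡1⇒n≡1 B≡1 , n^2≡1⇒n≡1 C≡1

a-descent : ∀ k a b c s → 0 < b → 0 < c → Sol k a b c → Case-i a b c → ¬ RootLabel a b c →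
            s * a ≡ quartic k b c → s < a
a-descent k a b c s 0<b 0<c sol (B≤a , C≤a) ¬root e =
  ≰⇒> λ a≤s → ¬root ([ ordered a≤s , swapped a≤s ]′ (≤-total (c ^ 2) (b ^ 2)))
  where
  ordered : a ≤ s → c ^ 2 ≤ b ^ 2 → RootLabel a b c
  ordered a≤s C≤B = a-descent-ordered k a b c s 0<c sol C≤B B≤a e a≤s
  swapped : a ≤ s → b ^ 2 ≤ c ^ 2 → RootLabel a b c
  swapped a≤s B≤C =
    let (a≡1 , c≡1 , b≡1) = a-descent-ordered k a c b s 0<b (sol-swap k a b c sol) B≤C C≤a
                                              (trans e (quartic-swap k b c)) a≤s
    in  a≡1 , b≡1 , c≡1

b-descent² : ∀ k a B C T → QuadRoot (k * C + 2 * a) ((a + C) * (a + C)) ((7 + k) * a * C) B →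
             T * B ≡ (a + C) * (a + C) → 1 ≤ a → 1 ≤ C → a < B → C ≤ B → ¬ B ≤ T
b-descent² k a B C T r e 1≤a 1≤C a<B C≤B B≤T with ≤-total C a
... | inj₁ C≤a = <-irrefl (sym (gap-at-a k a C B T r e 1≤C C≤a (<⇒≤ a<B) B≤T)) a<B
... | inj₂ a≤C =
  let (C≡1 , B≡C) = gap-at-C k a C B T r e 1≤a a≤C C≤B B≤T
  in  <⇒≱ a<B (subst (_≤ a) (sym (trans B≡C C≡1)) 1≤a)

b-descent : ∀ k a b c t → 0 < a → 0 < c → Sol k a b c → Case-ii a b c → t * b ≡ a + c ^ 2 → t < b
b-descent k a b c t 0<a 0<c sol (a<B , C≤B) e = ≰⇒> λ b≤t →
  b-descent² k a (b ^ 2) (c ^ 2) (t ^ 2) (to (sol⇔rootᵇ k a b c) sol)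
             (m*n≡o⇒m^2*n^2≡o*o {t} {b} {a + c ^ 2} e) 0<a (n^2>0 0<c) a<B C≤B (^-monoˡ-≤ 2 b≤t)

c-descent : ∀ k a b c t → 0 < a → 0 < b → Sol k a b c → Case-iii a b c → t * c ≡ a + b ^ 2 → t < c
c-descent k a b c t 0<a 0<b sol (a<C , B<C) =
  b-descent k a c b t 0<a 0<b (sol-swap k a b c sol) (a<C , <⇒≤ B<C)

-- The tree

data Axis : Set where
  a-axis b-axis c-axis : Axis

Case : Axis → ℕ → ℕ → ℕ → Set
Case a-axis = Case-i
Case b-axis = Case-ii
Case c-axis = Case-iii

case? : ∀ a b c → ∃[ d ] Case d a b c
case? a b c with a <? b ^ 2 | c ^ 2 ≤? b ^ 2 | c ^ 2 ≤? a
... | yes a<B | yes C≤B | _      = b-axis , a<B , C≤B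
... | yes a<B | no C≰B  | _      = c-axis , <-trans a<B (≰⇒> C≰B) , ≰⇒> C≰B
... | no a≮B  | _       | yes C≤a = a-axis , ≮⇒≥ a≮B , C≤a
... | no a≮B  | _       | no C≰a  = c-axis , ≰⇒> C≰a , ≤-<-trans (≮⇒≥ a≮B) (≰⇒> C≰a)

case-unique : ∀ {a b c} d e → Case d a b c → Case e a b c → d ≡ e
case-unique a-axis a-axis _ _ = refl
case-unique b-axis b-axis _ _ = refl
case-unique c-axis c-axis _ _ = refl
case-unique a-axis b-axis (B≤a , _) (a<B , _) = ⊥-elim (<⇒≱ a<B B≤a)
case-unique b-axis a-axis (a<B , _) (B≤a , _) = ⊥-elim (<⇒≱ a<B B≤a)
case-unique a-axis c-axis (_ , C≤a) (a<C , _) = ⊥-elim (<⇒≱ a<C C≤a)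
case-unique c-axis a-axis (a<C , _) (_ , C≤a) = ⊥-elim (<⇒≱ a<C C≤a)
case-unique b-axis c-axis (_ , C≤B) (_ , B<C) = ⊥-elim (<⇒≱ B<C C≤B)
case-unique c-axis b-axis (_ , B<C) (_ , C≤B) = ⊥-elim (<⇒≱ B<C C≤B)

×-≤-irrelevant : {m n o p : ℕ} (x y : (m ≤ n) × (o ≤ p)) → x ≡ y
×-≤-irrelevant (x₁ , x₂) (y₁ , y₂) = cong₂ _,_ (≤-irrelevant x₁ y₁) (≤-irrelevant x₂ y₂)

a-move-case : ∀ k a b c t → a ^ 2 < quartic k b c → t * a ≡ quartic k b c → Case-i t b c
a-move-case k a b c t a²<N e = <⇒≤ (m^2<n^2⇒m<n (b ^ 2) t (≤-<-trans (b⁴≤quartic k b c) N<t²))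
                             , <⇒≤ (m^2<n^2⇒m<n (c ^ 2) t (≤-<-trans (c⁴≤quartic k b c) N<t²))
  where N<t² = m^2<n⇒n<o^2 a t a²<N e

b-move-case : ∀ a b c t → b ^ 2 < a + c ^ 2 → t * b ≡ a + c ^ 2 → Case-ii a t c
b-move-case a b c t b²<N e = ≤-<-trans (m≤m+n a (c ^ 2)) N<t² , <⇒≤ (≤-<-trans (m≤n+m (c ^ 2) a) N<t²)
  where N<t² = m^2<n⇒n<o^2 b t b²<N e

c-move-case : ∀ a b c t → c ^ 2 < a + b ^ 2 → t * c ≡ a + b ^ 2 → Case-iii a b t
c-move-case a b c t c²<N e = ≤-<-trans (m≤m+n a (b ^ 2)) N<t² , ≤-<-trans (m≤n+m (b ^ 2) a) N<t²
  where N<t² = m^2<n⇒n<o^2 c t c²<N e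

positive : NonRoot k a b c → 0 < a × 0 < b × 0 < c
positive {k} child₁ = ≤-trans z<s (m≤n+m 2 k) , z<s , z<s
positive child₂ = z<s , z<s , z<s
positive child₃ = z<s , z<s , z<s
positive (i-b w _ e) with positive w
... | 0<a , _ , 0<c = 0<a , positive-factor e (≤-trans 0<a (m≤m+n _ _)) , 0<c
positive (i-c w _ e) with positive w
... | 0<a , 0<b , _ = 0<a , 0<b , positive-factor e (≤-trans 0<a (m≤m+n _ _))
positive {k} (ii-a {b = b} {c} w _ e) with positive w
... | _ , 0<b , 0<c = positive-factor e (quartic-positive k b c 0<b) , 0<b , 0<c
positive (ii-c w _ e) with positive w
... | 0<a , 0<b , _ = 0<a , 0<b , positive-factor e (≤-trans 0<a (m≤m+n _ _))
positive {k} (iii-a {b = b} {c} w _ e) with positive w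
... | _ , 0<b , 0<c = positive-factor e (quartic-positive k b c 0<b) , 0<b , 0<c
positive (iii-b w _ e) with positive w
... | 0<a , _ , 0<c = 0<a , positive-factor e (≤-trans 0<a (m≤m+n _ _)) , 0<c

-- A view of the last move of a path, indexed by the coordinate it changed: matching
-- two views at the same axis leaves only the compatible pairs of constructors.
data LastMove : Axis → NonRoot k a b c → Set where
  child₁ : LastMove a-axis (child₁ {k})
  child₂ : LastMove b-axis (child₂ {k})
  child₃ : LastMove c-axis (child₃ {k})
  i-b   : ∀ {w : NonRoot k a b c} {cs e} → LastMove b-axis (i-b {b' = t} w cs e)
  i-c   : ∀ {w : NonRoot k a b c} {cs e} → LastMove c-axis (i-c {c' = t} w cs e)
  ii-a  : ∀ {w : NonRoot k a b c} {cs e} → LastMove a-axis (ii-a {a' = t} w cs e)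
  ii-c  : ∀ {w : NonRoot k a b c} {cs e} → LastMove c-axis (ii-c {c' = t} w cs e)
  iii-a : ∀ {w : NonRoot k a b c} {cs e} → LastMove a-axis (iii-a {a' = t} w cs e)
  iii-b : ∀ {w : NonRoot k a b c} {cs e} → LastMove b-axis (iii-b {b' = t} w cs e)

-- The move that created a vertex is the one the vertex's own rule would undo.
lastMove : (w : NonRoot k a b c) → ∃[ d ] LastMove d w × Case d a b c
lastMove {k} child₁ = a-axis , child₁ , ≤-trans z<s (m≤n+m 2 k) , ≤-trans z<s (m≤n+m 2 k)
lastMove child₂ = b-axis , child₂ , s≤s (s≤s z≤n) , s≤s z≤n
lastMove child₃ = c-axis , child₃ , s≤s (s≤s z≤n) , s≤s (s≤s z≤n)
lastMove (i-b {a} {b} {c} {t} w (b²≤a , _) e) =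
  b-axis , i-b , b-move-case a b c t (≤-<-trans b²≤a (m<m+n a (n^2>0 (proj₂ (proj₂ (positive w)))))) e
lastMove (i-c {a} {b} {c} {t} w (_ , c²≤a) e) =
  c-axis , i-c , c-move-case a b c t (≤-<-trans c²≤a (m<m+n a (n^2>0 (proj₁ (proj₂ (positive w)))))) e
lastMove {k} (ii-a {a} {b} {c} {t} w (a<b² , _) e) =
  a-axis , ii-a , a-move-case k a b c t (<-≤-trans (^-monoˡ-< 2 a<b²) (b⁴≤quartic k b c)) e
lastMove (ii-c {a} {b} {c} {t} w (_ , c²≤b²) e) =
  c-axis , ii-c , c-move-case a b c t (≤-<-trans c²≤b² (m<n+m (b ^ 2) (proj₁ (positive w)))) e
lastMove {k} (iii-a {a} {b} {c} {t} w (a<c² , _) e) =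
  a-axis , iii-a , a-move-case k a b c t (<-≤-trans (^-monoˡ-< 2 a<c²) (c⁴≤quartic k b c)) e
lastMove (iii-b {a} {b} {c} {t} w (_ , b²<c²) e) =
  b-axis , iii-b , b-move-case a b c t (<-≤-trans b²<c² (m≤n+m (c ^ 2) a)) e

lastCase : (w : NonRoot k a b c) → Case (proj₁ (lastMove w)) a b c
lastCase w = proj₂ (proj₂ (lastMove w))

nonRoot⇒¬RootLabel : NonRoot k a b c → ¬ RootLabel a b c
nonRoot⇒¬RootLabel {k} child₁ (k+2≡1 , _) with trans (+-comm 2 k) k+2≡1
... | ()
nonRoot⇒¬RootLabel child₂ (_ , () , _)
nonRoot⇒¬RootLabel child₃ (_ , _ , ())
nonRoot⇒¬RootLabel w@(i-b _ _ _)   (refl , refl , refl) = <-irrefl refl (proj₁ (lastCase w))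
nonRoot⇒¬RootLabel w@(i-c _ _ _)   (refl , refl , refl) = <-irrefl refl (proj₁ (lastCase w))
nonRoot⇒¬RootLabel w@(ii-c _ _ _)  (refl , refl , refl) = <-irrefl refl (proj₁ (lastCase w))
nonRoot⇒¬RootLabel w@(iii-b _ _ _) (refl , refl , refl) = <-irrefl refl (proj₁ (lastCase w))
nonRoot⇒¬RootLabel (ii-a w (a<1 , _) _)  (refl , refl , refl) = <⇒≱ a<1 (proj₁ (positive w))
nonRoot⇒¬RootLabel (iii-a w (a<1 , _) _) (refl , refl , refl) = <⇒≱ a<1 (proj₁ (positive w))

no-a-move-onto-child₁ : NonRoot k a 1 1 → (k + 2) * a ≡ quartic k 1 1 → ⊥
no-a-move-onto-child₁ {k} {a} w e =
  nonRoot⇒¬RootLabel w (a≡1 , refl , refl)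
  where
  a≡1 : a ≡ 1
  a≡1 = cancel-factor (≤-trans z<s (m≤n+m 2 k)) e (trans (*-identityʳ (k + 2)) (sym (quartic-1-1 k)))

no-b-move-onto-child₂ : NonRoot k 1 b 1 → 2 * b ≡ 1 + 1 ^ 2 → ⊥
no-b-move-onto-child₂ w e = nonRoot⇒¬RootLabel w (refl , cancel-factor {o = 2} z<s e refl , refl)

no-c-move-onto-child₃ : NonRoot k 1 1 c → 2 * c ≡ 1 + 1 ^ 2 → ⊥
no-c-move-onto-child₃ w e = nonRoot⇒¬RootLabel w (refl , refl , cancel-factor {o = 2} z<s e refl)

nonRoot-unique : (w₁ w₂ : NonRoot k a b c) → w₁ ≡ w₂
same-move : ∀ {d} (w₁ w₂ : NonRoot k a b c) → 0 < a × 0 < b × 0 < c →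
            LastMove d w₁ → LastMove d w₂ → w₁ ≡ w₂

nonRoot-unique {a = a} {b} {c} w₁ w₂ with lastMove w₁ | lastMove w₂
... | d₁ , l₁ , cs₁ | d₂ , l₂ , cs₂ with case-unique {a} {b} {c} d₁ d₂ cs₁ cs₂
... | refl = same-move w₁ w₂ (positive w₁) l₁ l₂

same-move _ _ _ child₁ child₁ = refl
same-move _ _ _ child₂ child₂ = refl
same-move _ _ _ child₃ child₃ = refl
same-move _ (ii-a w _ e)  _ child₁ ii-a  = ⊥-elim (no-a-move-onto-child₁ w e)
same-move _ (iii-a w _ e) _ child₁ iii-a = ⊥-elim (no-a-move-onto-child₁ w e)
same-move (ii-a w _ e)  _ _ ii-a  child₁ = ⊥-elim (no-a-move-onto-child₁ w e)
same-move (iii-a w _ e) _ _ iii-a child₁ = ⊥-elim (no-a-move-onto-child₁ w e)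
same-move _ (i-b w _ e)   _ child₂ i-b   = ⊥-elim (no-b-move-onto-child₂ w e)
same-move _ (iii-b w _ e) _ child₂ iii-b = ⊥-elim (no-b-move-onto-child₂ w e)
same-move (i-b w _ e)   _ _ i-b   child₂ = ⊥-elim (no-b-move-onto-child₂ w e)
same-move (iii-b w _ e) _ _ iii-b child₂ = ⊥-elim (no-b-move-onto-child₂ w e)
same-move _ (i-c w _ e)   _ child₃ i-c   = ⊥-elim (no-c-move-onto-child₃ w e)
same-move _ (ii-c w _ e)  _ child₃ ii-c  = ⊥-elim (no-c-move-onto-child₃ w e)
same-move (i-c w _ e)   _ _ i-c   child₃ = ⊥-elim (no-c-move-onto-child₃ w e)
same-move (ii-c w _ e)  _ _ ii-c  child₃ = ⊥-elim (no-c-move-onto-child₃ w e)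
same-move (ii-a w cs e) (ii-a w′ cs′ e′) (0<a , _) ii-a ii-a with cancel-factor 0<a e e′
... | refl with nonRoot-unique w w′
... | refl = cong₂ (ii-a w) (×-≤-irrelevant cs cs′) (≡-irrelevant e e′)
same-move (iii-a w cs e) (iii-a w′ cs′ e′) (0<a , _) iii-a iii-a with cancel-factor 0<a e e′
... | refl with nonRoot-unique w w′
... | refl = cong₂ (iii-a w) (×-≤-irrelevant cs cs′) (≡-irrelevant e e′)
same-move (ii-a w cs e) (iii-a w′ cs′ e′) (0<a , _) ii-a iii-a with cancel-factor 0<a e e′
... | refl = ⊥-elim (<⇒≱ (proj₂ cs′) (proj₂ cs))
same-move (iii-a w cs e) (ii-a w′ cs′ e′) (0<a , _) iii-a ii-a with cancel-factor 0<a e e′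
... | refl = ⊥-elim (<⇒≱ (proj₂ cs) (proj₂ cs′))
same-move (i-b w cs e) (i-b w′ cs′ e′) (_ , 0<b , _) i-b i-b with cancel-factor 0<b e e′
... | refl with nonRoot-unique w w′
... | refl = cong₂ (i-b w) (×-≤-irrelevant cs cs′) (≡-irrelevant e e′)
same-move (iii-b w cs e) (iii-b w′ cs′ e′) (_ , 0<b , _) iii-b iii-b with cancel-factor 0<b e e′
... | refl with nonRoot-unique w w′
... | refl = cong₂ (iii-b w) (×-≤-irrelevant cs cs′) (≡-irrelevant e e′)
same-move (i-b w cs e) (iii-b w′ cs′ e′) (_ , 0<b , _) i-b iii-b with cancel-factor 0<b e e′
... | refl = ⊥-elim (<⇒≱ (proj₁ cs′) (proj₂ cs))
same-move (iii-b w cs e) (i-b w′ cs′ e′) (_ , 0<b , _) iii-b i-b with cancel-factor 0<b e e′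
... | refl = ⊥-elim (<⇒≱ (proj₁ cs) (proj₂ cs′))
same-move (i-c w cs e) (i-c w′ cs′ e′) (_ , _ , 0<c) i-c i-c with cancel-factor 0<c e e′
... | refl with nonRoot-unique w w′
... | refl = cong₂ (i-c w) (×-≤-irrelevant cs cs′) (≡-irrelevant e e′)
same-move (ii-c w cs e) (ii-c w′ cs′ e′) (_ , _ , 0<c) ii-c ii-c with cancel-factor 0<c e e′
... | refl with nonRoot-unique w w′
... | refl = cong₂ (ii-c w) (×-≤-irrelevant cs cs′) (≡-irrelevant e e′)
same-move (i-c w cs e) (ii-c w′ cs′ e′) (_ , _ , 0<c) i-c ii-c with cancel-factor 0<c e e′
... | refl = ⊥-elim (<⇒≱ (proj₁ cs′) (proj₁ cs))
same-move (ii-c w cs e) (i-c w′ cs′ e′) (_ , _ , 0<c) ii-c i-c with cancel-factor 0<c e e′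
... | refl = ⊥-elim (<⇒≱ (proj₁ cs) (proj₁ cs′))

vertex-unique : (v w : Vertex k a b c) → v ≡ w
vertex-unique root        root         = refl
vertex-unique root        (nonroot w)  = ⊥-elim (nonRoot⇒¬RootLabel w (refl , refl , refl))
vertex-unique (nonroot w) root         = ⊥-elim (nonRoot⇒¬RootLabel w (refl , refl , refl))
vertex-unique (nonroot w) (nonroot w′) = cong nonroot (nonRoot-unique w w′)

-- The parent's own descent points away from the child, which rules out one of its
-- three cases.
a-extend : ∀ k a b c s → Vertex k s b c → 0 < b → 0 < c → Sol k s b c →
           a * s ≡ quartic k b c → s < a → Vertex k a b c
a-extend k a _ _ _ root _ _ _ e _ = subst (λ x → Vertex k x 1 1) (sym a≡k+2) (nonroot child₁)
  where
  a≡k+2 : a ≡ k + 2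
  a≡k+2 = trans (sym (*-identityʳ a)) (trans e (quartic-1-1 k))
a-extend k a b c s (nonroot w) 0<b 0<c sol e s<a = attach (case? s b c)
  where
  attach : ∃[ d ] Case d s b c → Vertex k a b c
  attach (a-axis , cs) =
    ⊥-elim (<-asym s<a (a-descent k s b c a 0<b 0<c sol cs (nonRoot⇒¬RootLabel w) e))
  attach (b-axis , cs) = nonroot (ii-a w cs e)
  attach (c-axis , cs) = nonroot (iii-a w cs e)

b-extend : ∀ k a b c t → Vertex k a t c → 0 < a → 0 < c → Sol k a t c →
           b * t ≡ a + c ^ 2 → t < b → Vertex k a b c
b-extend k _ b _ _ root _ _ _ e _ =
  subst (λ x → Vertex k 1 x 1) (sym (trans (sym (*-identityʳ b)) e)) (nonroot child₂)
b-extend k a b c t (nonroot w) 0<a 0<c sol e t<b = attach (case? a t c)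
  where
  attach : ∃[ d ] Case d a t c → Vertex k a b c
  attach (a-axis , cs) = nonroot (i-b w cs e)
  attach (b-axis , cs) = ⊥-elim (<-asym t<b (b-descent k a t c b 0<a 0<c sol cs e))
  attach (c-axis , cs) = nonroot (iii-b w cs e)

c-extend : ∀ k a b c t → Vertex k a b t → 0 < a → 0 < b → Sol k a b t →
           c * t ≡ a + b ^ 2 → t < c → Vertex k a b c
c-extend k _ _ c _ root _ _ _ e _ =
  subst (λ x → Vertex k 1 1 x) (sym (trans (sym (*-identityʳ c)) e)) (nonroot child₃)
c-extend k a b c t (nonroot w) 0<a 0<b sol e t<c = attach (case? a b t)
  where
  attach : ∃[ d ] Case d a b t → Vertex k a b c
  attach (a-axis , cs) = nonroot (i-c w cs e)
  attach (b-axis , cs) = nonroot (ii-c w cs e)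
  attach (c-axis , cs) = ⊥-elim (<-asym t<c (c-descent k a b t c 0<a 0<b sol cs e))

root-at : RootLabel a b c → Vertex k a b c
root-at (refl , refl , refl) = root

vertex : ∀ k a b c → Acc _<_ (a + b + c) → 0 < a → 0 < b → 0 < c → Sol k a b c → Vertex k a b c
vertex k a b c (acc rec) 0<a 0<b 0<c sol = step ((a ≟ 1) ×-dec (b ≟ 1) ×-dec (c ≟ 1)) (case? a b c)
  where
  step : Dec (RootLabel a b c) → ∃[ d ] Case d a b c → Vertex k a b c
  step (yes at-root) _ = root-at at-root
  step (no ¬root) (a-axis , cs) =
    let (s , sa≡ , sol′) = a-jump k a b c 0<a sol
        s<a = a-descent k a b c s 0<b 0<c sol cs ¬root sa≡
        0<s = positive-factor sa≡ (quartic-positive k b c 0<b)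
        v = vertex k s b c (rec (+-monoˡ-< c (+-monoˡ-< b s<a))) 0<s 0<b 0<c sol′
    in  a-extend k a b c s v 0<b 0<c sol′ (trans (*-comm a s) sa≡) s<a
  step (no _) (b-axis , cs) =
    let (t , tb≡ , sol′) = b-jump k a b c 0<b sol
        t<b = b-descent k a b c t 0<a 0<c sol cs tb≡
        0<t = positive-factor tb≡ (≤-trans 0<a (m≤m+n a _))
        v = vertex k a t c (rec (+-monoˡ-< c (+-monoʳ-< a t<b))) 0<a 0<t 0<c sol′
    in  b-extend k a b c t v 0<a 0<c sol′ (trans (*-comm b t) tb≡) t<b
  step (no _) (c-axis , cs) =
    let (t , tc≡ , sol′) = c-jump k a b c 0<c sol
        t<c = c-descent k a b c t 0<a 0<b sol cs tc≡
        0<t = positive-factor tc≡ (≤-trans 0<a (m≤m+n a _))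
        v = vertex k a b t (rec (+-monoʳ-< (a + b) t<c)) 0<a 0<b 0<t sol′
    in  c-extend k a b c t v 0<a 0<b sol′ (trans (*-comm c t) tc≡) t<c

theorem1p2 : (k x y z : ℕ) → 0 < x → 0 < y → 0 < z → Sol k x y z →
    Σ (Vertex k x y z) (λ v → (w : Vertex k x y z) → w ≡ v)
theorem1p2 k x y z 0<x 0<y 0<z sol =
  let v = vertex k x y z (<-wellFounded (x + y + z)) 0<x 0<y 0<z sol
  in  v , λ w → vertex-unique w v
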